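{- Let $n,m$ be positive integers and let $A$ be a binary $n\times m$ matrix in $\mathfrak{C}_{n\times m}$, with $r(A)=\langle x_1,\dots,x_n\rangle$ and $c(A)=\langle y_1,\dots,y_m\rangle$. Let $s$ be the number of entries equal to $1$ in the first row of $A$ and $t$ the number of entries equal to $1$ in the first column of $A$ (so $0\le s\le m$, $0\le t\le n$). Then $x_1=2^s-1$ and $y_1=2^t-1$.
   Context: For a binary $n\times m$ matrix $A=(a_{ij})$, $r(A)=\langle x_1,\dots,x_n\rangle$ with $x_i=\sum_{j=1}^m a_{ij}2^{m-j}$ and $c(A)=\langle y_1,\dots,y_m\rangle$ with $y_j=\sum_{i=1}^n a_{ij}2^{n-i}$. $\mathfrak{C}_{n\times m}$ is the set of binary $n\times m$ matrices with $x_1\le\cdots\le x_n$ and $y_1\le\cdots\le y_m$. -}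

module Defs where

open import Data.Nat using (ℕ; zero; suc; _+_; _*_; _∸_; _^_; _≤_)
open import Data.Fin using (Fin; toℕ)
open import Data.Bool using (Bool; true; false)
open import Data.Vec.Functional using (Vector)
open import Data.Vec.Functional using (foldr)
open import Data.Product using (_×_)

BinMatrix : ℕ → ℕ → Set
BinMatrix n m = Fin n → Fin m → Bool

bit : Bool → ℕ
bit true  = 1
bit false = 0

∑ : (k : ℕ) → (Fin k → ℕ) → ℕ
∑ k f = foldr _+_ 0 f

-- x_i = Σ_j a_ij 2^(m-j)  (paper's 1-indexed j; here j is 0-indexed so exponent m ∸ 1 ∸ toℕ j)
rowVal : ∀ {n m} → BinMatrix n m → Fin n → ℕ
rowVal {n} {m} A i = ∑ m (λ j → bit (A i j) * 2 ^ (m ∸ suc (toℕ j)))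

colVal : ∀ {n m} → BinMatrix n m → Fin m → ℕ
colVal {n} {m} A j = ∑ n (λ i → bit (A i j) * 2 ^ (n ∸ suc (toℕ i)))

Nondecreasing : ∀ {k} → (Fin k → ℕ) → Set
Nondecreasing {k} f = ∀ (i j : Fin k) → toℕ i ≤ toℕ j → f i ≤ f j

InC : ∀ {n m} → BinMatrix n m → Set
InC A = Nondecreasing (rowVal A) × Nondecreasing (colVal A)

onesRow : ∀ {n m} → BinMatrix n m → Fin n → ℕ
onesRow {n} {m} A i = ∑ m (λ j → bit (A i j))

onesCol : ∀ {n m} → BinMatrix n m → Fin m → ℕ
onesCol {n} {m} A j = ∑ n (λ i → bit (A i j))

{-# OPTIONS --safe #-}
module Submission where

-- The leading digit of c(A)'s entries is the first row of A, and it outweighs all the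
-- other digits together; so y₁ ≤ ⋯ ≤ yₘ forces the first row to have the shape 0⋯01⋯1,
-- i.e. x₁ = 2ˢ − 1. The statement for the first column is the same fact for the transpose.

open import Defs
open import Data.Nat using (ℕ; zero; suc; _∸_; _^_; _+_; _*_; _≤_; _<_; z≤n; s≤s)
open import Data.Nat.Properties
open import Data.Fin using (Fin; toℕ; zero) renaming (suc to fsuc)
open import Data.Bool using (Bool; true; false)
open import Data.Vec.Functional using (tail; transpose)
open import Data.Product using (_×_; _,_)
open import Data.Sum using (_⊎_; inj₁; inj₂)
open import Relation.Nullary using (contradiction)
open import Relation.Binary.PropositionalEquality
  using (_≡_; refl; sym; cong; module ≡-Reasoning)

fromBits : ∀ k → (Fin k → Bool) → ℕ
fromBits k f = ∑ k (λ i → bit (f i) * 2 ^ (k ∸ suc (toℕ i)))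

popCount : ∀ k → (Fin k → Bool) → ℕ
popCount k f = ∑ k (λ i → bit (f i))

UpwardClosed : ∀ {k} → (Fin k → Bool) → Set
UpwardClosed {k} f = ∀ (i j : Fin k) → toℕ i ≤ toℕ j → f i ≡ true → f j ≡ true

bit≤1 : ∀ b → bit b ≤ 1
bit≤1 true  = s≤s z≤n
bit≤1 false = z≤n

fromBits<2^ : ∀ k (f : Fin k → Bool) → fromBits k f < 2 ^ k
fromBits<2^ zero    f = s≤s z≤n
fromBits<2^ (suc k) f = begin-strict
  bit (f zero) * 2 ^ k + fromBits k (tail f)
    <⟨ +-mono-≤-< (*-monoˡ-≤ (2 ^ k) (bit≤1 (f zero))) (fromBits<2^ k (tail f)) ⟩
  1 * 2 ^ k + 2 ^ k  ≡⟨ +-comm (1 * 2 ^ k) (2 ^ k) ⟩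
  2 ^ suc k          ∎
  where open ≤-Reasoning

fromBits-leading-< : ∀ k (f g : Fin (suc k) → Bool) → f zero ≡ false → g zero ≡ true →
                     fromBits (suc k) f < fromBits (suc k) g
fromBits-leading-< k f g f₀ g₀ rewrite f₀ | g₀ =
  <-≤-trans (fromBits<2^ k (tail f))
            (≤-trans (≤-reflexive (sym (*-identityˡ (2 ^ k)))) (m≤m+n (1 * 2 ^ k) _))

fromBits-all-true : ∀ k (f : Fin k → Bool) → (∀ i → f i ≡ true) → suc (fromBits k f) ≡ 2 ^ k
fromBits-all-true zero    f all = refl
fromBits-all-true (suc k) f all rewrite all zero = begin
  suc (1 * 2 ^ k + fromBits k (tail f))  ≡⟨ sym (+-suc (1 * 2 ^ k) _) ⟩
  1 * 2 ^ k + suc (fromBits k (tail f))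
    ≡⟨ cong (1 * 2 ^ k +_) (fromBits-all-true k (tail f) (λ i → all (fsuc i))) ⟩
  1 * 2 ^ k + 2 ^ k                      ≡⟨ +-comm (1 * 2 ^ k) (2 ^ k) ⟩
  2 ^ suc k                              ∎
  where open ≡-Reasoning

popCount-all-true : ∀ k (f : Fin k → Bool) → (∀ i → f i ≡ true) → popCount k f ≡ k
popCount-all-true zero    f all = refl
popCount-all-true (suc k) f all rewrite all zero =
  cong suc (popCount-all-true k (tail f) (λ i → all (fsuc i)))

upwardClosed-cases : ∀ {k} (f : Fin (suc k) → Bool) → UpwardClosed f →
                     f zero ≡ false ⊎ (∀ i → f i ≡ true)
upwardClosed-cases f up with f zero in f₀
... | false = inj₁ refl
... | true  = inj₂ (λ i → up zero i z≤n f₀)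

fromBits-upwardClosed : ∀ k (f : Fin k → Bool) → UpwardClosed f →
                        suc (fromBits k f) ≡ 2 ^ popCount k f
fromBits-upwardClosed zero    f up = refl
fromBits-upwardClosed (suc k) f up with upwardClosed-cases f up
... | inj₁ f₀ rewrite f₀ =
  fromBits-upwardClosed k (tail f) (λ i j i≤j → up (fsuc i) (fsuc j) (s≤s i≤j))
... | inj₂ all = begin
  suc (fromBits (suc k) f)  ≡⟨ fromBits-all-true (suc k) f all ⟩
  2 ^ suc k                 ≡⟨ cong (2 ^_) (sym (popCount-all-true (suc k) f all)) ⟩
  2 ^ popCount (suc k) f    ∎
  where open ≡-Reasoning

firstRow-upwardClosed : ∀ {n m} (A : BinMatrix (suc n) m) → Nondecreasing (colVal A) →
                        UpwardClosed (A zero)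
firstRow-upwardClosed A colsUp j k j≤k a₀ⱼ with A zero k in a₀ₖ
... | true  = refl
... | false = contradiction (colsUp j k j≤k)
                (<⇒≱ (fromBits-leading-< _ (λ i → A i k) (λ i → A i j) a₀ₖ a₀ⱼ))

firstRow-value : ∀ {n m} (A : BinMatrix (suc n) m) → Nondecreasing (colVal A) →
                 rowVal A zero ≡ 2 ^ onesRow A zero ∸ 1
firstRow-value {m = m} A colsUp =
  cong (_∸ 1) (fromBits-upwardClosed m (A zero) (firstRow-upwardClosed A colsUp))

corollary1 : (n m : ℕ) → (A : BinMatrix (suc n) (suc m)) → InC A →
    (rowVal A zero ≡ 2 ^ onesRow A zero ∸ 1) × (colVal A zero ≡ 2 ^ onesCol A zero ∸ 1)
corollary1 n m A (rowsUp , colsUp) = firstRow-value A colsUp , firstRow-value (transpose A) rowsUp
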